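{- For each $n\ge 2$, $H_n$ is not regular. For each odd $n\ge 3$, $H_n$ is transmission regular with transmission $t(H_n)=\frac{3n^2+1}{2}$.
   Context: $H_n$ is the graph with vertex set $\{v_1,\dots,v_{2n},u_1,\dots,u_n\}$ and edge set $\{v_iv_{i+1}:1\le i\le 2n-1\}\cup\{v_{2n}v_1\}\cup\{u_iv_{2i-1},u_iv_{2i},u_iv_{2i+1}:1\le i\le n-1\}\cup\{u_nv_{2n-1},u_nv_{2n},u_nv_1\}$. The transmission of a vertex $v$ is $t(v)=\sum_{w}d(v,w)$, where $d$ is the shortest-path distance; a graph is transmission regular if all vertices have the same transmission, which is then called the transmission $t(G)$ of the graph. A graph is regular if all vertices have the same degree. -}

module Defs where

open import Data.Nat using (ℕ; zero; suc; _+_; _*_; _≤_; _≡ᵇ_)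
open import Data.Bool using (Bool; true; false; if_then_else_; _∨_)
open import Data.Fin using (Fin; toℕ)
open import Data.List using (List; map; _++_; allFin; filter; length)
open import Data.Nat.ListAction using (sum)
open import Data.Sum using (_⊎_; inj₁; inj₂)
open import Data.Product using (Σ; ∃; _×_)
open import Relation.Binary.PropositionalEquality using (_≡_)
open import Relation.Nullary using (¬_)
open import Data.Bool.Properties using (T?)
open import Data.Bool using (T)

-- Generic finite graphs: a vertex type, an explicit list of all vertices
-- (each exactly once), and a Boolean adjacency relation.

record Graph : Set₁ where
  field
    V        : Set
    vertices : List V
    adj      : V → V → Bool
open Graph public

degree : (G : Graph) → V G → ℕ
degree G v = length (filter (λ w → T? (adj G v w)) (vertices G))

Regular : Graph → Set
Regular G = ∃ λ (k : ℕ) → ∀ (v : V G) → degree G v ≡ k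

data Walk (G : Graph) : V G → V G → ℕ → Set where
  here : ∀ {v} → Walk G v v 0
  step : ∀ {v u w k} → adj G v u ≡ true → Walk G u w k → Walk G v w (suc k)

IsDistance : (G : Graph) → (V G → V G → ℕ) → Set
IsDistance G d = ∀ v w → Walk G v w (d v w) × (∀ k → Walk G v w k → d v w ≤ k)

transmission : (G : Graph) → (V G → V G → ℕ) → V G → ℕ
transmission G d v = sum (map (d v) (vertices G))

TransmissionRegularWith : Graph → ℕ → Set
TransmissionRegularWith G t =
  Σ (V G → V G → ℕ) λ d → IsDistance G d × (∀ v → transmission G d v ≡ t)

-- The graph H_n.  Vertices (0-based): inj₁ a = v_{a+1} (a < 2n),
-- inj₂ j = u_{j+1} (j < n).

nextMod : ℕ → ℕ → ℕ
nextMod m a = if suc a ≡ᵇ m then 0 else suc a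

HV : ℕ → Set
HV n = Fin (n + n) ⊎ Fin n

Hadj : (n : ℕ) → HV n → HV n → Bool
Hadj n (inj₁ a) (inj₁ b) =
  (toℕ b ≡ᵇ nextMod (n + n) (toℕ a)) ∨ (toℕ a ≡ᵇ nextMod (n + n) (toℕ b))
Hadj n (inj₁ b) (inj₂ j) =
  (toℕ b ≡ᵇ 2 * toℕ j) ∨ (toℕ b ≡ᵇ 2 * toℕ j + 1) ∨ (toℕ b ≡ᵇ nextMod (n + n) (2 * toℕ j + 1))
Hadj n (inj₂ j) (inj₁ b) =
  (toℕ b ≡ᵇ 2 * toℕ j) ∨ (toℕ b ≡ᵇ 2 * toℕ j + 1) ∨ (toℕ b ≡ᵇ nextMod (n + n) (2 * toℕ j + 1))
Hadj n (inj₂ _) (inj₂ _) = false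

H : ℕ → Graph
H n = record
  { V = HV n
  ; vertices = map inj₁ (allFin (n + n)) ++ map inj₂ (allFin n)
  ; adj = Hadj n
  }

-- Put the rim vertex v_{a+1} at position a of the cycle of length 2n and the hub
-- u_{j+1} at position 2j+1, the middle of its three rim neighbours. The distance in
-- H_n is the cyclic distance cnorm ∣a − b∣ of the positions, where
-- cnorm x = min (x, 2n − x), raised to 1 between a hub and a rim vertex: it drops
-- by at most 1 along every edge, and it is attained by walks along the rim that
-- enter and leave hubs through the neighbours of their positions.
-- Rotating the cycle, the transmission of a rim vertex is n² plus a sum over the
-- odd positions that only depends on the parity of its own position, and that of
-- a hub is n² + 1 plus the even-position sum E = Σⱼ cnorm 2j. For n = 2k + 1,
-- E = 2k² + 2k, so the odd-position sum is n² − E = E + 1 and all transmissions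
-- equal n² + E + 1 = (3n² + 1)/2. As for regularity, u₁ has degree 3 and v₃ degree 4.
module Submission where

open import Defs
open import Data.Bool using (Bool; true; false; if_then_else_; _∨_)
open import Data.Bool.Properties using (T?; T-≡; ∨-comm)
open import Data.Empty using (⊥-elim)
open import Data.Fin using (Fin; toℕ; fromℕ<; fromℕ) renaming (zero to fzero; suc to fsuc)
open import Data.Fin.Properties using (toℕ-fromℕ<; toℕ-fromℕ; toℕ-injective; toℕ<n)
open import Data.List using ([]; _∷_; map; _++_; allFin; filter; length; tabulate)
open import Data.List.Properties using (map-++; map-tabulate; map-∘)
open import Data.Nat
open import Data.Nat.Properties
open import Data.Nat.ListAction using (sum)
open import Data.Nat.ListAction.Properties using (sum-++)
open import Data.Nat.DivMod using (m*n/n≡m; m≡m%n+[m/n]*n)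
open import Data.Nat.Tactic.RingSolver using (solve-∀)
open import Algebra.Properties.CommutativeSemigroup +-commutativeSemigroup using (interchange; xy∙z≈xz∙y)
open import Data.Product using (∃; _×_; _,_; proj₁; proj₂)
open import Data.Sum using (_⊎_; inj₁; inj₂)
open import Function using (_∘_; id)
open import Relation.Binary.PropositionalEquality
open import Relation.Nullary using (¬_; yes; no; contradiction)
open import Function.Bundles using (Equivalence)

-- Finite sums

sumTo : (ℕ → ℕ) → ℕ → ℕ
sumTo f zero    = 0
sumTo f (suc k) = f 0 + sumTo (f ∘ suc) k

sumTo-cong : ∀ {f g} k → (∀ b → b < k → f b ≡ g b) → sumTo f k ≡ sumTo g k
sumTo-cong zero    eq = refl
sumTo-cong (suc k) eq = cong₂ _+_ (eq 0 z<s) (sumTo-cong k (λ b b<k → eq (suc b) (s<s b<k)))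

sumTo-const : ∀ c k → sumTo (λ _ → c) k ≡ k * c
sumTo-const c zero    = refl
sumTo-const c (suc k) = cong (c +_) (sumTo-const c k)

sumTo-distrib-+ : ∀ f g k → sumTo (λ b → f b + g b) k ≡ sumTo f k + sumTo g k
sumTo-distrib-+ f g zero    = refl
sumTo-distrib-+ f g (suc k) = begin
  f 0 + g 0 + sumTo (λ b → f (suc b) + g (suc b)) k ≡⟨ cong (f 0 + g 0 +_) (sumTo-distrib-+ (f ∘ suc) (g ∘ suc) k) ⟩
  f 0 + g 0 + (sumTo (f ∘ suc) k + sumTo (g ∘ suc) k) ≡⟨ interchange (f 0) (g 0) _ _ ⟩
  f 0 + sumTo (f ∘ suc) k + (g 0 + sumTo (g ∘ suc) k) ∎
  where open ≡-Reasoning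

sumTo-+ : ∀ f k l → sumTo f (k + l) ≡ sumTo f k + sumTo (λ b → f (k + b)) l
sumTo-+ f zero    l = refl
sumTo-+ f (suc k) l = trans (cong (f 0 +_) (sumTo-+ (f ∘ suc) k l)) (sym (+-assoc (f 0) _ _))

sumTo-suc : ∀ f k → sumTo f (suc k) ≡ sumTo f k + f k
sumTo-suc f zero    = +-comm (f 0) 0
sumTo-suc f (suc k) = trans (cong (f 0 +_) (sumTo-suc (f ∘ suc) k)) (sym (+-assoc (f 0) _ _))

sumTo-even+odd : ∀ f k → sumTo f (k + k) ≡ sumTo (λ j → f (2 * j)) k + sumTo (λ j → f (suc (2 * j))) k
sumTo-even+odd f zero    = refl
sumTo-even+odd f (suc k) = begin
  sumTo f (suc k + suc k)                     ≡⟨ cong (sumTo f ∘ suc) (+-suc k k) ⟩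
  f 0 + (f 1 + sumTo (f ∘ suc ∘ suc) (k + k))
    ≡⟨ cong (f 0 +_) (cong (_+_ (f 1)) (sumTo-even+odd (f ∘ suc ∘ suc) k)) ⟩
  f 0 + (f 1 + (sumTo (λ j → f (2 + 2 * j)) k + sumTo (λ j → f (3 + 2 * j)) k))
    ≡⟨ trans (sym (+-assoc (f 0) (f 1) _)) (interchange (f 0) (f 1) _ _) ⟩
  f 0 + sumTo (λ j → f (2 + 2 * j)) k + (f 1 + sumTo (λ j → f (3 + 2 * j)) k)
    ≡⟨ cong₂ (λ x y → f 0 + x + (f 1 + y)) (shift f) (shift (f ∘ suc)) ⟩
  sumTo (λ j → f (2 * j)) (suc k) + sumTo (λ j → f (suc (2 * j))) (suc k) ∎
  where
  open ≡-Reasoning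
  shift : ∀ g → sumTo (λ j → g (2 + 2 * j)) k ≡ sumTo (λ j → g (2 * suc j)) k
  shift g = sumTo-cong k (λ j _ → cong g (sym (*-suc 2 j)))

sum-tabulate : ∀ {k} (f : Fin k → ℕ) (g : ℕ → ℕ) → (∀ i → f i ≡ g (toℕ i)) →
               sum (tabulate f) ≡ sumTo g k
sum-tabulate {zero}  f g eq = refl
sum-tabulate {suc k} f g eq = cong₂ _+_ (eq fzero) (sum-tabulate (f ∘ fsuc) (g ∘ suc) (eq ∘ fsuc))

sum-map-allFin : ∀ {k} (f : Fin k → ℕ) (g : ℕ → ℕ) → (∀ i → f i ≡ g (toℕ i)) →
                 sum (map f (allFin k)) ≡ sumTo g k
sum-map-allFin f g eq = trans (cong sum (map-tabulate id f)) (sum-tabulate f g eq)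

≡⇒≡ᵇ-true : ∀ {a b} → a ≡ b → (a ≡ᵇ b) ≡ true
≡⇒≡ᵇ-true {a} {b} a≡b = Equivalence.to T-≡ (≡⇒≡ᵇ a b a≡b)

≡ᵇ-true⇒≡ : ∀ a b → (a ≡ᵇ b) ≡ true → a ≡ b
≡ᵇ-true⇒≡ a b eq = ≡ᵇ⇒≡ a b (Equivalence.from T-≡ eq)

≡ᵇ∨-elim : ∀ a b {x} → ((a ≡ᵇ b) ∨ x) ≡ true → a ≡ b ⊎ x ≡ true
≡ᵇ∨-elim a b e with a ≡ᵇ b in eq
... | true  = inj₁ (≡ᵇ-true⇒≡ a b eq)
... | false = inj₂ e

≡ᵇ∨-intro : ∀ {a b} x → a ≡ b → ((a ≡ᵇ b) ∨ x) ≡ true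
≡ᵇ∨-intro x a≡b rewrite ≡⇒≡ᵇ-true a≡b = refl

∨-introʳ : ∀ x {y} → y ≡ true → (x ∨ y) ≡ true
∨-introʳ true  _  = refl
∨-introʳ false eq = eq

-- Walks

module _ {G : Graph} where

  SymmetricAdj : Set
  SymmetricAdj = ∀ x y → adj G x y ≡ adj G y x

  walk-snoc : ∀ {x y z k} → Walk G x y k → adj G y z ≡ true → Walk G x z (suc k)
  walk-snoc here       e = step e here
  walk-snoc (step e w) f = step e (walk-snoc w f)

  walk-reverse : SymmetricAdj → ∀ {x y k} → Walk G x y k → Walk G y x k
  walk-reverse sym-adj here                      = here
  walk-reverse sym-adj {x} (step {u = u} e w) = walk-snoc (walk-reverse sym-adj w) (trans (sym-adj u x) e)

  walk-++ : ∀ {x y z k l} → Walk G x y k → Walk G y z l → Walk G x z (k + l)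
  walk-++ here       w = w
  walk-++ (step e v) w = step e (walk-++ v w)

  walk-length-≥ : (d : V G → V G → ℕ) → (∀ v → d v v ≡ 0) →
                  (∀ {v u} w → adj G v u ≡ true → d v w ≤ suc (d u w)) →
                  ∀ {v w k} → Walk G v w k → d v w ≤ k
  walk-length-≥ d d-refl d-step {v} here = ≤-reflexive (d-refl v)
  walk-length-≥ d d-refl d-step {w = w} (step e p) = ≤-trans (d-step w e) (s≤s (walk-length-≥ d d-refl d-step p))

  mkIsDistance : (d : V G → V G → ℕ) → (∀ v w → Walk G v w (d v w)) → (∀ v → d v v ≡ 0) →
                 (∀ {v u} w → adj G v u ≡ true → d v w ≤ suc (d u w)) → IsDistance G d
  mkIsDistance d walk d-refl d-step v w = walk v w , λ _ → walk-length-≥ d d-refl d-step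

  IsDistance-step : ∀ {d} → IsDistance G d → ∀ {v u} w → adj G v u ≡ true → d v w ≤ suc (d u w)
  IsDistance-step isd {u = u} w e = proj₂ (isd _ w) _ (step e (proj₁ (isd u w)))

walk-map : ∀ {G G′ : Graph} (f : V G → V G′) → (∀ {x y} → adj G x y ≡ true → adj G′ (f x) (f y) ≡ true) →
           ∀ {x y k} → Walk G x y k → Walk G′ (f x) (f y) k
walk-map f f-adj here       = here
walk-map f f-adj (step e w) = step (f-adj e) (walk-map f f-adj w)

-- The cycle C_m

rimAdj : ℕ → ℕ → ℕ → Bool
rimAdj m a b = (b ≡ᵇ nextMod m a) ∨ (a ≡ᵇ nextMod m b)

rimAdj-elim : ∀ m a b → rimAdj m a b ≡ true → b ≡ nextMod m a ⊎ a ≡ nextMod m b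
rimAdj-elim m a b e with ≡ᵇ∨-elim b (nextMod m a) e
... | inj₁ b≡ = inj₁ b≡
... | inj₂ a≡ = inj₂ (≡ᵇ-true⇒≡ a (nextMod m b) a≡)

rimAdj-intro : ∀ m a b → b ≡ nextMod m a ⊎ a ≡ nextMod m b → rimAdj m a b ≡ true
rimAdj-intro m a b (inj₁ b≡) = ≡ᵇ∨-intro _ b≡
rimAdj-intro m a b (inj₂ a≡) = ∨-introʳ (b ≡ᵇ nextMod m a) (≡⇒≡ᵇ-true a≡)

Cycle : ℕ → Graph
Cycle m = record { V = Fin m ; vertices = allFin m ; adj = λ a b → rimAdj m (toℕ a) (toℕ b) }

Cycle-symmetric : ∀ {m} → SymmetricAdj {Cycle m}
Cycle-symmetric {m} a b = ∨-comm (toℕ b ≡ᵇ nextMod m (toℕ a)) (toℕ a ≡ᵇ nextMod m (toℕ b))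

nextMod-cases : ∀ m a → (suc a ≢ m × nextMod m a ≡ suc a) ⊎ (suc a ≡ m × nextMod m a ≡ 0)
nextMod-cases m a with suc a ≡ᵇ m in eq
... | true  = inj₂ (≡ᵇ-true⇒≡ (suc a) m eq , refl)
... | false = inj₁ ((λ e → contradiction (trans (sym eq) (≡⇒≡ᵇ-true e)) λ ()) , refl)

nextMod-< : ∀ {m a} → suc a < m → nextMod m a ≡ suc a
nextMod-< {m} {a} a+1<m with nextMod-cases m a
... | inj₁ (_ , next≡) = next≡
... | inj₂ (a+1≡m , _) = contradiction a+1≡m (<⇒≢ a+1<m)

nextMod-last : ∀ L → nextMod (suc L) L ≡ 0
nextMod-last L with nextMod-cases (suc L) L
... | inj₁ (L+1≢L+1 , _) = contradiction refl L+1≢L+1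
... | inj₂ (_ , next≡)   = next≡

cnorm : ℕ → ℕ → ℕ
cnorm m x = x ⊓ (m ∸ x)

cnorm-mirror : ∀ {m x} → x ≤ m → cnorm m (m ∸ x) ≡ cnorm m x
cnorm-mirror {m} {x} x≤m = trans (cong ((m ∸ x) ⊓_) (m∸[m∸n]≡n x≤m)) (⊓-comm (m ∸ x) x)

m∸n≤1+m∸1+n : ∀ m n → m ∸ n ≤ suc (m ∸ suc n)
m∸n≤1+m∸1+n zero    zero    = z≤n
m∸n≤1+m∸1+n zero    (suc n) = z≤n
m∸n≤1+m∸1+n (suc m) zero    = ≤-refl
m∸n≤1+m∸1+n (suc m) (suc n) = m∸n≤1+m∸1+n m n

cnorm-suc-≤ : ∀ m x → cnorm m (suc x) ≤ suc (cnorm m x)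
cnorm-suc-≤ m x = ⊓-monoʳ-≤ (suc x) (≤-trans (∸-monoʳ-≤ m (n≤1+n x)) (n≤1+n _))

cnorm-≤-suc : ∀ m x → cnorm m x ≤ suc (cnorm m (suc x))
cnorm-≤-suc m x = ⊓-mono-≤ (m≤n⇒m≤1+n (n≤1+n x)) (m∸n≤1+m∸1+n m x)

∣suc-∣-cases : ∀ a w → ∣ suc a - w ∣ ≡ suc ∣ a - w ∣ ⊎ ∣ a - w ∣ ≡ suc ∣ suc a - w ∣
∣suc-∣-cases a       zero    = inj₁ (cong suc (sym (∣-∣-identityʳ a)))
∣suc-∣-cases zero    (suc w) = inj₂ refl
∣suc-∣-cases (suc a) (suc w) = ∣suc-∣-cases a w

cnorm-∣last-∣ : ∀ {m a w} → suc a ≡ m → w < m → cnorm m ∣ a - w ∣ ≡ cnorm m (suc w)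
cnorm-∣last-∣ {_} {a} {w} refl (s≤s w≤a) = begin
  cnorm (suc a) ∣ a - w ∣               ≡⟨ cong (cnorm (suc a)) (m≤n⇒∣n-m∣≡n∸m w≤a) ⟩
  cnorm (suc a) (a ∸ w)                 ≡⟨ cnorm-mirror (≤-trans (m∸n≤m a w) (n≤1+n a)) ⟨
  cnorm (suc a) (suc a ∸ (a ∸ w))       ≡⟨ cong (cnorm (suc a)) (+-∸-assoc 1 (m∸n≤m a w)) ⟩
  cnorm (suc a) (suc (a ∸ (a ∸ w)))     ≡⟨ cong (cnorm (suc a) ∘ suc) (m∸[m∸n]≡n w≤a) ⟩
  cnorm (suc a) (suc w)                 ∎
  where open ≡-Reasoning

cnorm-nextMod : ∀ {m a w} → w < m →
                cnorm m ∣ a - w ∣ ≤ suc (cnorm m ∣ nextMod m a - w ∣) ×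
                cnorm m ∣ nextMod m a - w ∣ ≤ suc (cnorm m ∣ a - w ∣)
cnorm-nextMod {m} {a} {w} w<m with nextMod-cases m a
... | inj₂ (a+1≡m , next≡) rewrite next≡ | cnorm-∣last-∣ a+1≡m w<m = cnorm-suc-≤ m w , cnorm-≤-suc m w
... | inj₁ (_ , next≡) rewrite next≡ with ∣suc-∣-cases a w
...   | inj₁ eq rewrite eq = cnorm-≤-suc m _ , cnorm-suc-≤ m _
...   | inj₂ eq rewrite eq = cnorm-suc-≤ m _ , cnorm-≤-suc m _

cycleDist : (m : ℕ) → Fin m → Fin m → ℕ
cycleDist m a b = cnorm m ∣ toℕ a - toℕ b ∣

cycleDist-refl : ∀ {m} (a : Fin m) → cycleDist m a a ≡ 0
cycleDist-refl {m} a = cong (cnorm m) (∣n-n∣≡0 (toℕ a))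

cycleDist-step : ∀ {m a b} w → adj (Cycle m) a b ≡ true → cycleDist m a w ≤ suc (cycleDist m b w)
cycleDist-step {m} {a} {b} w e with rimAdj-elim m (toℕ a) (toℕ b) e
... | inj₁ b≡ rewrite b≡ = proj₁ (cnorm-nextMod (toℕ<n w))
... | inj₂ a≡ rewrite a≡ = proj₂ (cnorm-nextMod (toℕ<n w))

nextMod⇒adj : ∀ {m} {a b : Fin m} → nextMod m (toℕ a) ≡ toℕ b → adj (Cycle m) a b ≡ true
nextMod⇒adj {m} {a} {b} next≡ = rimAdj-intro m (toℕ a) (toℕ b) (inj₁ (sym next≡))

rimForward : ∀ {m} k (a b : Fin m) → toℕ a + k ≡ toℕ b → Walk (Cycle m) a b k
rimForward zero    a b a+0≡b = subst (λ c → Walk _ a c 0) (toℕ-injective (trans (sym (+-identityʳ _)) a+0≡b)) here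
rimForward (suc k) a b a+k+1≡b = step (nextMod⇒adj (trans (nextMod-< a+1<m) (sym (toℕ-fromℕ< a+1<m))))
                                      (rimForward k (fromℕ< a+1<m) b a′+k≡b)
  where
  a+1<m : suc (toℕ a) < _
  a+1<m = ≤-<-trans (m<m+n (toℕ a) z<s) (subst (_< _) (sym a+k+1≡b) (toℕ<n b))
  a′+k≡b : toℕ (fromℕ< a+1<m) + k ≡ toℕ b
  a′+k≡b = trans (cong (_+ k) (toℕ-fromℕ< a+1<m)) (trans (sym (+-suc (toℕ a) k)) a+k+1≡b)

wrap-length : ∀ {a b L} → a ≤ b → b ≤ L → (L ∸ b) + suc a ≡ suc L ∸ (b ∸ a)
wrap-length {a} {b} {L} a≤b b≤L = sym (begin
  suc L ∸ (b ∸ a)                               ≡⟨ cong (_∸ (b ∸ a)) L+1≡ ⟨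
  (L ∸ b) + suc a + (b ∸ a) ∸ (b ∸ a)           ≡⟨ m+n∸n≡m ((L ∸ b) + suc a) (b ∸ a) ⟩
  (L ∸ b) + suc a                               ∎)
  where
  open ≡-Reasoning
  reassoc : ∀ x a y → x + suc a + y ≡ suc (x + (a + y))
  reassoc = solve-∀
  L+1≡ : (L ∸ b) + suc a + (b ∸ a) ≡ suc L
  L+1≡ = trans (reassoc (L ∸ b) a (b ∸ a))
               (cong suc (trans (cong ((L ∸ b) +_) (m+[n∸m]≡n a≤b)) (m∸n+n≡m b≤L)))

cycleWalk-≤ : ∀ {L} (a b : Fin (suc L)) → toℕ a ≤ toℕ b → Walk (Cycle (suc L)) a b (cycleDist (suc L) a b)
cycleWalk-≤ {L} a b a≤b rewrite m≤n⇒∣m-n∣≡n∸m a≤b with (toℕ b ∸ toℕ a) ≤? (suc L ∸ (toℕ b ∸ toℕ a))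
... | yes short = subst (Walk _ a b) (sym (m≤n⇒m⊓n≡m short)) (rimForward _ a b (m+[n∸m]≡n a≤b))
... | no  long  = subst (Walk _ a b) (trans (wrap-length a≤b b≤L) (sym (m≥n⇒m⊓n≡n (<⇒≤ (≰⇒> long)))))
                        (walk-reverse Cycle-symmetric around)
  where
  b≤L : toℕ b ≤ L
  b≤L = s≤s⁻¹ (toℕ<n b)
  wrap : adj (Cycle (suc L)) (fromℕ L) fzero ≡ true
  wrap = nextMod⇒adj (trans (cong (nextMod (suc L)) (toℕ-fromℕ L)) (nextMod-last L))
  around : Walk (Cycle (suc L)) b a ((L ∸ toℕ b) + suc (toℕ a))
  around = walk-++ (rimForward (L ∸ toℕ b) b (fromℕ L) (trans (m+[n∸m]≡n b≤L) (sym (toℕ-fromℕ L))))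
                   (step wrap (rimForward (toℕ a) fzero a refl))

cycleWalk : ∀ {m} (a b : Fin m) → Walk (Cycle m) a b (cycleDist m a b)
cycleWalk {suc L} a b with ≤-total (toℕ a) (toℕ b)
... | inj₁ a≤b = cycleWalk-≤ a b a≤b
... | inj₂ b≤a = subst (Walk _ a b) (cong (cnorm (suc L)) (∣-∣-comm (toℕ b) (toℕ a)))
                       (walk-reverse Cycle-symmetric (cycleWalk-≤ b a b≤a))

cycle-isDistance : ∀ m → IsDistance (Cycle m) (cycleDist m)
cycle-isDistance m = mkIsDistance (cycleDist m) cycleWalk cycleDist-refl
                                  (λ {a} {b} → cycleDist-step {a = a} {b})

nextMod-odd≢odd : ∀ m i j → nextMod m (suc (2 * i)) ≢ suc (2 * j)
nextMod-odd≢odd m i j eq with nextMod-cases m (suc (2 * i))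
... | inj₁ (_ , next≡) = even≢odd (suc i) j (trans (*-suc 2 i) (trans (sym next≡) eq))
... | inj₂ (_ , next≡) = 0≢1+n (trans (sym next≡) eq)

odd-not-rimAdj : ∀ m i j → rimAdj m (suc (2 * i)) (suc (2 * j)) ≢ true
odd-not-rimAdj m i j e with rimAdj-elim m _ _ e
... | inj₁ j≡ = nextMod-odd≢odd m i j (sym j≡)
... | inj₂ i≡ = nextMod-odd≢odd m j i (sym i≡)

hubAdj : ℕ → ℕ → ℕ → Bool
hubAdj m j b = (b ≡ᵇ 2 * j) ∨ (b ≡ᵇ 2 * j + 1) ∨ (b ≡ᵇ nextMod m (2 * j + 1))

hubAdj-elim : ∀ m j b → hubAdj m j b ≡ true →
              b ≡ 2 * j ⊎ b ≡ suc (2 * j) ⊎ b ≡ nextMod m (suc (2 * j))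
hubAdj-elim m j b e with ≡ᵇ∨-elim b (2 * j) e
... | inj₁ b≡ = inj₁ b≡
... | inj₂ e′ with ≡ᵇ∨-elim b (2 * j + 1) e′
...   | inj₁ b≡ = inj₂ (inj₁ (trans b≡ (+-comm _ 1)))
...   | inj₂ e″ = inj₂ (inj₂ (trans (≡ᵇ-true⇒≡ b _ e″) (cong (nextMod m) (+-comm _ 1))))

hubAdj-intro : ∀ m j b → b ≡ 2 * j ⊎ b ≡ suc (2 * j) ⊎ b ≡ nextMod m (suc (2 * j)) →
               hubAdj m j b ≡ true
hubAdj-intro m j b (inj₁ b≡)        = ≡ᵇ∨-intro _ b≡
hubAdj-intro m j b (inj₂ (inj₁ b≡)) = ∨-introʳ (b ≡ᵇ 2 * j) (≡ᵇ∨-intro _ (trans b≡ (+-comm 1 _)))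
hubAdj-intro m j b (inj₂ (inj₂ b≡)) = ∨-introʳ (b ≡ᵇ 2 * j) (∨-introʳ (b ≡ᵇ 2 * j + 1)
                                        (≡⇒≡ᵇ-true (trans b≡ (cong (nextMod m) (+-comm 1 _)))))

rimAdj-odd⇒hubAdj : ∀ m j b → rimAdj m (suc (2 * j)) b ≡ true → hubAdj m j b ≡ true
rimAdj-odd⇒hubAdj m j b e with rimAdj-elim m _ _ e
... | inj₁ b≡ = hubAdj-intro m j b (inj₂ (inj₂ b≡))
... | inj₂ 2j+1≡ with nextMod-cases m b
...   | inj₁ (_ , next≡) = hubAdj-intro m j b (inj₁ (sym (suc-injective (trans 2j+1≡ next≡))))
...   | inj₂ (_ , next≡) = contradiction (trans 2j+1≡ next≡) λ ()

hubAdj⇒close : ∀ m j b → suc (2 * j) < m → hubAdj m j b ≡ true →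
               b ≡ suc (2 * j) ⊎ rimAdj m b (suc (2 * j)) ≡ true
hubAdj⇒close m j b 2j+1<m e with hubAdj-elim m j b e
... | inj₁ b≡        = inj₂ (rimAdj-intro m b _ (inj₁ (sym (trans (cong (nextMod m) b≡) (nextMod-< 2j+1<m)))))
... | inj₂ (inj₁ b≡) = inj₁ b≡
... | inj₂ (inj₂ b≡) = inj₂ (rimAdj-intro m b _ (inj₂ b≡))

2j+1<2n : ∀ {j n} → j < n → suc (2 * j) < n + n
2j+1<2n {j} {n} j<n = subst (_≤ n + n) (2+2*j≡ j) (+-mono-≤ j<n j<n)
  where
  2+2*j≡ : ∀ j → suc j + suc j ≡ suc (suc (2 * j))
  2+2*j≡ = solve-∀

-- Distances in H_n

module _ (n : ℕ) where

  H-symmetric : SymmetricAdj {H n}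
  H-symmetric (inj₁ a) (inj₁ b) = Cycle-symmetric a b
  H-symmetric (inj₁ a) (inj₂ j) = refl
  H-symmetric (inj₂ j) (inj₁ a) = refl
  H-symmetric (inj₂ i) (inj₂ j) = refl

  hubPos< : (j : Fin n) → suc (2 * toℕ j) < n + n
  hubPos< j = 2j+1<2n (toℕ<n j)

  hubPos : Fin n → Fin (n + n)
  hubPos j = fromℕ< (hubPos< j)

  toℕ-hubPos : ∀ j → toℕ (hubPos j) ≡ suc (2 * toℕ j)
  toℕ-hubPos j = toℕ-fromℕ< (hubPos< j)

  hubPos-injective : ∀ {i j} → hubPos i ≡ hubPos j → i ≡ j
  hubPos-injective {i} {j} eq = toℕ-injective (*-cancelˡ-≡ (toℕ i) (toℕ j) 2
    (suc-injective (trans (sym (toℕ-hubPos i)) (trans (cong toℕ eq) (toℕ-hubPos j)))))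

  hubs-nonadjacent : ∀ {i j} → adj (Cycle (n + n)) (hubPos i) (hubPos j) ≢ true
  hubs-nonadjacent {i} {j} e = odd-not-rimAdj (n + n) (toℕ i) (toℕ j)
    (subst₂ (λ x y → rimAdj (n + n) x y ≡ true) (toℕ-hubPos i) (toℕ-hubPos j) e)

  hub-adj-centre : ∀ j → Hadj n (inj₂ j) (inj₁ (hubPos j)) ≡ true
  hub-adj-centre j = hubAdj-intro (n + n) (toℕ j) _ (inj₂ (inj₁ (toℕ-hubPos j)))

  hub-adj-rimNeighbour : ∀ {j q} → adj (Cycle (n + n)) (hubPos j) q ≡ true → Hadj n (inj₂ j) (inj₁ q) ≡ true
  hub-adj-rimNeighbour {j} {q} e = rimAdj-odd⇒hubAdj (n + n) (toℕ j) (toℕ q)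
    (subst (λ x → rimAdj (n + n) x (toℕ q) ≡ true) (toℕ-hubPos j) e)

  rim-hub-adj⇒close : ∀ b j → Hadj n (inj₁ b) (inj₂ j) ≡ true →
                      b ≡ hubPos j ⊎ adj (Cycle (n + n)) b (hubPos j) ≡ true
  rim-hub-adj⇒close b j e with hubAdj⇒close (n + n) (toℕ j) (toℕ b) (hubPos< j) e
  ... | inj₁ b≡ = inj₁ (toℕ-injective (trans b≡ (sym (toℕ-hubPos j))))
  ... | inj₂ b~ = inj₂ (subst (λ x → rimAdj (n + n) (toℕ b) x ≡ true) (sym (toℕ-hubPos j)) b~)

  pos : HV n → Fin (n + n)
  pos (inj₁ a) = a
  pos (inj₂ j) = hubPos j

  adj⇒pos-close : ∀ x y → Hadj n x y ≡ true → pos x ≡ pos y ⊎ adj (Cycle (n + n)) (pos x) (pos y) ≡ true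
  adj⇒pos-close (inj₁ a) (inj₁ b) e = inj₂ e
  adj⇒pos-close (inj₁ b) (inj₂ j) e = rim-hub-adj⇒close b j e
  adj⇒pos-close (inj₂ j) (inj₁ b) e with rim-hub-adj⇒close b j e
  ... | inj₁ b≡hub = inj₁ (sym b≡hub)
  ... | inj₂ b~hub = inj₂ (trans (Cycle-symmetric (hubPos j) b) b~hub)
  adj⇒pos-close (inj₂ i) (inj₂ j) ()

  dist : HV n → HV n → ℕ
  dist (inj₁ a) (inj₁ b) = cycleDist (n + n) a b
  dist (inj₁ a) (inj₂ j) = 1 ⊔ cycleDist (n + n) a (hubPos j)
  dist (inj₂ j) (inj₁ b) = 1 ⊔ cycleDist (n + n) (hubPos j) b
  dist (inj₂ i) (inj₂ j) = cycleDist (n + n) (hubPos i) (hubPos j)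

  cycleDist-pos-≤-dist : ∀ x y → cycleDist (n + n) (pos x) (pos y) ≤ dist x y
  cycleDist-pos-≤-dist (inj₁ a) (inj₁ b) = ≤-refl
  cycleDist-pos-≤-dist (inj₁ a) (inj₂ j) = m≤n⊔m 1 _
  cycleDist-pos-≤-dist (inj₂ j) (inj₁ b) = m≤n⊔m 1 _
  cycleDist-pos-≤-dist (inj₂ i) (inj₂ j) = ≤-refl

  dist-≤-1⊔cycleDist-pos : ∀ x y → dist x y ≤ 1 ⊔ cycleDist (n + n) (pos x) (pos y)
  dist-≤-1⊔cycleDist-pos (inj₁ a) (inj₁ b) = m≤n⊔m 1 _
  dist-≤-1⊔cycleDist-pos (inj₁ a) (inj₂ j) = ≤-refl
  dist-≤-1⊔cycleDist-pos (inj₂ j) (inj₁ b) = ≤-refl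
  dist-≤-1⊔cycleDist-pos (inj₂ i) (inj₂ j) = m≤n⊔m 1 _

  dist-refl : ∀ x → dist x x ≡ 0
  dist-refl (inj₁ a) = cycleDist-refl a
  dist-refl (inj₂ j) = cycleDist-refl (hubPos j)

  dist-step : ∀ {x y} z → Hadj n x y ≡ true → dist x z ≤ suc (dist y z)
  dist-step {x} {y} z e = begin
    dist x z                                     ≤⟨ dist-≤-1⊔cycleDist-pos x z ⟩
    1 ⊔ cycleDist (n + n) (pos x) (pos z)        ≤⟨ ⊔-monoʳ-≤ 1 close ⟩
    suc (cycleDist (n + n) (pos y) (pos z))      ≤⟨ s≤s (cycleDist-pos-≤-dist y z) ⟩
    suc (dist y z)                               ∎
    where
    open ≤-Reasoning
    close : cycleDist (n + n) (pos x) (pos z) ≤ suc (cycleDist (n + n) (pos y) (pos z))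
    close with adj⇒pos-close x y e
    ... | inj₁ x≡y  = m≤n⇒m≤1+n (≤-reflexive (cong (λ p → cycleDist (n + n) p (pos z)) x≡y))
    ... | inj₂ x~y  = IsDistance-step (cycle-isDistance (n + n)) {pos x} {pos y} (pos z) x~y

  hubWalk : ∀ {j b k} → Walk (Cycle (n + n)) (hubPos j) b k → Walk (H n) (inj₂ j) (inj₁ b) (1 ⊔ k)
  hubWalk {j} here = step (hub-adj-centre j) here
  hubWalk {j} (step {u = q} e w) = step (hub-adj-rimNeighbour {j} {q} e) (walk-map inj₁ id w)

  -- Hub positions are odd, hence never adjacent: a rim walk between two of them has
  -- length 0 or at least 2, and its first and last steps can be taken through the hubs.
  hubHubWalk : ∀ {i j p q k} → p ≡ hubPos i → q ≡ hubPos j → Walk (Cycle (n + n)) p q k →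
               Walk (H n) (inj₂ i) (inj₂ j) k
  hubHubWalk {i} p≡ q≡ here =
    subst (λ j → Walk (H n) (inj₂ i) (inj₂ j) 0) (hubPos-injective (trans (sym p≡) q≡)) here
  hubHubWalk {i} {j} refl q≡ (step e here) =
    ⊥-elim (hubs-nonadjacent {i} {j} (subst (λ q → adj (Cycle (n + n)) (hubPos i) q ≡ true) q≡ e))
  hubHubWalk {i} refl refl (step {u = q} e w@(step _ _)) =
    step (hub-adj-rimNeighbour {i} {q} e) (walk-reverse H-symmetric (hubWalk (walk-reverse Cycle-symmetric w)))

  H-walk : ∀ x y → Walk (H n) x y (dist x y)
  H-walk (inj₁ a) (inj₁ b) = walk-map inj₁ id (cycleWalk a b)
  H-walk (inj₁ a) (inj₂ j) = walk-reverse H-symmetric (hubWalk (walk-reverse Cycle-symmetric (cycleWalk a (hubPos j))))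
  H-walk (inj₂ j) (inj₁ b) = hubWalk (cycleWalk (hubPos j) b)
  H-walk (inj₂ i) (inj₂ j) = hubHubWalk refl refl (cycleWalk (hubPos i) (hubPos j))

  H-isDistance : IsDistance (H n) dist
  H-isDistance = mkIsDistance dist H-walk dist-refl (λ {x} {y} → dist-step {x} {y})

-- Degrees

count : (ℕ → Bool) → ℕ → ℕ
count p = sumTo (λ b → if p b then 1 else 0)

count-none : ∀ p k → (∀ b → p b ≡ false) → count p k ≡ 0
count-none p k none = begin
  count p k             ≡⟨ sumTo-cong k (λ b _ → cong (λ x → if x then 1 else 0) (none b)) ⟩
  sumTo (λ _ → 0) k     ≡⟨ sumTo-const 0 k ⟩
  k * 0                 ≡⟨ *-zeroʳ k ⟩
  0                     ∎
  where open ≡-Reasoning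

degree-as-sum : ∀ G v → degree G v ≡ sum (map (λ w → if adj G v w then 1 else 0) (vertices G))
degree-as-sum G v = go (vertices G)
  where
  go : ∀ ws → length (filter (λ w → T? (adj G v w)) ws) ≡ sum (map (λ w → if adj G v w then 1 else 0) ws)
  go []       = refl
  go (w ∷ ws) with adj G v w
  ... | true  = cong suc (go ws)
  ... | false = go ws

sum-vertices-H : ∀ n (f : HV n → ℕ) (g h : ℕ → ℕ) →
                 (∀ a → f (inj₁ a) ≡ g (toℕ a)) → (∀ j → f (inj₂ j) ≡ h (toℕ j)) →
                 sum (map f (vertices (H n))) ≡ sumTo g (n + n) + sumTo h n
sum-vertices-H n f g h f₁≡ f₂≡ = begin
  sum (map f (map inj₁ (allFin (n + n)) ++ map inj₂ (allFin n)))
    ≡⟨ cong sum (map-++ f (map inj₁ (allFin (n + n))) (map inj₂ (allFin n))) ⟩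
  sum (map f (map inj₁ (allFin (n + n))) ++ map f (map inj₂ (allFin n)))
    ≡⟨ sum-++ (map f (map inj₁ (allFin (n + n)))) (map f (map inj₂ (allFin n))) ⟩
  sum (map f (map inj₁ (allFin (n + n)))) + sum (map f (map inj₂ (allFin n)))
    ≡⟨ cong₂ _+_ (cong sum (map-∘ (allFin (n + n)))) (cong sum (map-∘ (allFin n))) ⟨
  sum (map (f ∘ inj₁) (allFin (n + n))) + sum (map (f ∘ inj₂) (allFin n))
    ≡⟨ cong₂ _+_ (sum-map-allFin (f ∘ inj₁) g f₁≡) (sum-map-allFin (f ∘ inj₂) h f₂≡) ⟩
  sumTo g (n + n) + sumTo h n ∎
  where open ≡-Reasoning

degree-H : ∀ n v (p q : ℕ → Bool) →
           (∀ a → Hadj n v (inj₁ a) ≡ p (toℕ a)) → (∀ j → Hadj n v (inj₂ j) ≡ q (toℕ j)) →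
           degree (H n) v ≡ count p (n + n) + count q n
degree-H n v p q p≡ q≡ = trans (degree-as-sum (H n) v)
  (sum-vertices-H n _ _ _ (λ a → cong (λ x → if x then 1 else 0) (p≡ a))
                          (λ j → cong (λ x → if x then 1 else 0) (q≡ j)))

count-hubAdj₀ : ∀ {m} → 4 ≤ m → count (hubAdj m 0) m ≡ 3
count-hubAdj₀ {suc (suc (suc (suc M)))} (s≤s (s≤s (s≤s (s≤s _)))) = cong (3 +_) (count-none _ M (λ _ → refl))

count-rimAdj₂ : ∀ {m} → 4 ≤ m → count (rimAdj m 2) m ≡ 2
count-rimAdj₂ {suc (suc (suc (suc M)))} (s≤s (s≤s (s≤s (s≤s _)))) = cong (2 +_) (count-none _ M far)
  where
  far : ∀ b → rimAdj (4 + M) 2 (4 + b) ≡ false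
  far b with suc (4 + b) ≡ᵇ 4 + M
  ... | true  = refl
  ... | false = refl

count-hubAdj-2 : ∀ {m} → 4 ≤ m → ∀ k → count (λ j → hubAdj m j 2) (2 + k) ≡ 2
count-hubAdj-2 {m} (s≤s (s≤s (s≤s (s≤s _)))) k = cong (2 +_) (count-none _ k far)
  where
  far : ∀ j → hubAdj m (2 + j) 2 ≡ false
  far j = subst (λ y → ((2 ≡ᵇ y) ∨ (2 ≡ᵇ y + 1) ∨ (2 ≡ᵇ nextMod m (y + 1))) ≡ false)
                (sym (*-distribˡ-+ 2 2 j)) (far′ (2 * j))
    where
    far′ : ∀ x → ((2 ≡ᵇ 4 + x) ∨ (2 ≡ᵇ 4 + x + 1) ∨ (2 ≡ᵇ nextMod m (4 + x + 1))) ≡ false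
    far′ x with suc (4 + x + 1) ≡ᵇ m
    ... | true  = refl
    ... | false = refl

4≤2+k+2+k : ∀ k → 4 ≤ (2 + k) + (2 + k)
4≤2+k+2+k k = +-mono-≤ (s≤s (s≤s z≤n)) (s≤s (s≤s z≤n))

degree-hub₀ : ∀ k → degree (H (2 + k)) (inj₂ fzero) ≡ 3
degree-hub₀ k = trans
  (degree-H (2 + k) (inj₂ fzero) (hubAdj ((2 + k) + (2 + k)) 0) (λ _ → false) (λ _ → refl) (λ _ → refl))
                      (cong₂ _+_ (count-hubAdj₀ (4≤2+k+2+k k)) (count-none _ (2 + k) (λ _ → refl)))

degree-rim₂ : ∀ k → ∃ λ v → degree (H (2 + k)) v ≡ 4
degree-rim₂ k = inj₁ v₂ , trans
  (degree-H (2 + k) (inj₁ v₂) (rimAdj ((2 + k) + (2 + k)) 2) (λ j → hubAdj ((2 + k) + (2 + k)) j 2)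
            (λ a → cong (λ t → rimAdj ((2 + k) + (2 + k)) t (toℕ a)) (toℕ-fromℕ< 2<m))
            (λ j → cong (hubAdj ((2 + k) + (2 + k)) (toℕ j)) (toℕ-fromℕ< 2<m)))
  (cong₂ _+_ (count-rimAdj₂ (4≤2+k+2+k k)) (count-hubAdj-2 (4≤2+k+2+k k) k))
  where
  2<m : 2 < (2 + k) + (2 + k)
  2<m = ≤-trans (n≤1+n 3) (4≤2+k+2+k k)
  v₂ : Fin ((2 + k) + (2 + k))
  v₂ = fromℕ< 2<m

H-not-regular : ∀ n → 2 ≤ n → ¬ Regular (H n)
H-not-regular (suc (suc k)) (s≤s (s≤s z≤n)) (d , regular) with degree-rim₂ k
... | v , degree-v≡4 =
  contradiction (trans (sym (degree-hub₀ k)) (trans (regular (inj₂ fzero)) (trans (sym (regular v)) degree-v≡4))) λ ()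

-- Transmissions

Palindromic : ℕ → (ℕ → ℕ) → Set
Palindromic m φ = ∀ x → x ≤ m → φ (m ∸ x) ≡ φ x

cnorm-palindromic : ∀ m → Palindromic m (cnorm m)
cnorm-palindromic m x = cnorm-mirror

palindromic-∘ : ∀ {m φ} f → Palindromic m φ → Palindromic m (f ∘ φ)
palindromic-∘ f pal x x≤m = cong f (pal x x≤m)

palindromic-∣-last∣ : ∀ {L φ} → Palindromic (suc L) φ → ∀ {a} → a ≤ L → φ ∣ a - L ∣ ≡ φ (suc a)
palindromic-∣-last∣ {φ = φ} pal a≤L = trans (cong φ (m≤n⇒∣m-n∣≡n∸m a≤L)) (pal _ (s≤s a≤L))

sumTo-rotate : ∀ {m φ} → Palindromic m φ → ∀ {a} → a < m → sumTo (λ b → φ ∣ a - b ∣) m ≡ sumTo φ m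
sumTo-rotate {suc L} pal {zero}  _       = refl
sumTo-rotate {suc L} {φ} pal {suc a} a+1<m = trans rotate-by-one (sumTo-rotate pal (<-trans (n<1+n a) a+1<m))
  where
  open ≡-Reasoning
  rotate-by-one : sumTo (λ b → φ ∣ suc a - b ∣) (suc L) ≡ sumTo (λ b → φ ∣ a - b ∣) (suc L)
  rotate-by-one = begin
    φ (suc a) + sumTo (λ b → φ ∣ a - b ∣) L    ≡⟨ +-comm (φ (suc a)) _ ⟩
    sumTo (λ b → φ ∣ a - b ∣) L + φ (suc a)
      ≡⟨ cong (sumTo (λ b → φ ∣ a - b ∣) L +_) (palindromic-∣-last∣ pal {a} (<⇒≤ (s≤s⁻¹ a+1<m))) ⟨
    sumTo (λ b → φ ∣ a - b ∣) L + φ ∣ a - L ∣  ≡⟨ sumTo-suc _ L ⟨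
    sumTo (λ b → φ ∣ a - b ∣) (suc L)           ∎

hubSum : ℕ → (ℕ → ℕ) → ℕ → ℕ
hubSum n φ a = sumTo (λ j → φ ∣ a - suc (2 * j) ∣) n

hubSum-+2 : ∀ n {φ} → Palindromic (n + n) φ → ∀ {a} → 2 + a < n + n → hubSum n φ (2 + a) ≡ hubSum n φ a
hubSum-+2 zero        pal _ = refl
hubSum-+2 (suc n) {φ} pal {a} a+2<m = begin
  φ (suc a) + sumTo (λ j → φ ∣ 2 + a - suc (2 * suc j) ∣) n
    ≡⟨ cong (φ (suc a) +_) (sumTo-cong n (λ j _ → cong (λ x → φ ∣ a - x ∣) (+-suc j (j + 0)))) ⟩
  φ (suc a) + sumTo (λ j → φ ∣ a - suc (2 * j) ∣) n
    ≡⟨ +-comm (φ (suc a)) _ ⟩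
  sumTo (λ j → φ ∣ a - suc (2 * j) ∣) n + φ (suc a)
    ≡⟨ cong (sumTo (λ j → φ ∣ a - suc (2 * j) ∣) n +_)
            (trans (cong (λ x → φ ∣ a - x ∣) 2n+1≡) (palindromic-∣-last∣ pal {a} a≤L)) ⟨
  sumTo (λ j → φ ∣ a - suc (2 * j) ∣) n + φ ∣ a - suc (2 * n) ∣
    ≡⟨ sumTo-suc _ n ⟨
  hubSum (suc n) φ a ∎
  where
  open ≡-Reasoning
  2n+1≡ : suc (2 * n) ≡ n + suc n
  2n+1≡ = trans (cong (suc ∘ (n +_)) (+-identityʳ n)) (sym (+-suc n n))
  a≤L : a ≤ n + suc n
  a≤L = ≤-trans (n≤1+n a) (s≤s⁻¹ (<-trans (n<1+n _) a+2<m))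

hubSum-parity : ∀ n {φ} → Palindromic (n + n) φ → ∀ a → a < n + n →
                hubSum n φ a ≡ hubSum n φ 0 ⊎ hubSum n φ a ≡ hubSum n φ 1
hubSum-parity n pal zero          _     = inj₁ refl
hubSum-parity n pal (suc zero)    _     = inj₂ refl
hubSum-parity n pal (suc (suc a)) a+2<m with hubSum-parity n pal a (<-trans (n<1+n a) (<-trans (n<1+n _) a+2<m))
... | inj₁ eq = inj₁ (trans (hubSum-+2 n pal a+2<m) eq)
... | inj₂ eq = inj₂ (trans (hubSum-+2 n pal a+2<m) eq)

hubSum-odd : ∀ n {φ} → Palindromic (n + n) φ → ∀ i → suc (2 * i) < n + n →
             hubSum n φ (suc (2 * i)) ≡ hubSum n φ 1
hubSum-odd n pal zero    _ = refl
hubSum-odd n pal (suc i) 2i+3<m rewrite *-suc 2 i =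
  trans (hubSum-+2 n pal 2i+3<m) (hubSum-odd n pal i (<-trans (n<1+n _) (<-trans (n<1+n _) 2i+3<m)))

cnorm-low : ∀ {n x} → x ≤ n → cnorm (n + n) x ≡ x
cnorm-low {n} {x} x≤n = m≤n⇒m⊓n≡m (begin
  x              ≤⟨ x≤n ⟩
  n              ≡⟨ m+n∸m≡n n n ⟨
  n + n ∸ n      ≤⟨ ∸-monoʳ-≤ (n + n) x≤n ⟩
  n + n ∸ x      ∎)
  where open ≤-Reasoning

cnorm-high : ∀ {n y} → y ≤ n → cnorm (n + n) (n + y) ≡ n ∸ y
cnorm-high {n} {y} y≤n = trans (cong ((n + y) ⊓_) ([m+n]∸[m+o]≡n∸o n n y))
                               (m≥n⇒m⊓n≡n (≤-trans (m∸n≤m n y) (m≤m+n n y)))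

1⊔cnorm : ∀ {m x} → 0 < x → x < m → 1 ⊔ cnorm m x ≡ cnorm m x
1⊔cnorm 0<x x<m = m≤n⇒m⊔n≡n (⊓-glb 0<x (m<n⇒0<n∸m x<m))

sumTo-cnorm : ∀ n → sumTo (cnorm (n + n)) (n + n) ≡ n * n
sumTo-cnorm n = begin
  sumTo (cnorm (n + n)) (n + n)                                      ≡⟨ sumTo-+ (cnorm (n + n)) n n ⟩
  sumTo (cnorm (n + n)) n + sumTo (λ y → cnorm (n + n) (n + y)) n
    ≡⟨ cong₂ _+_ (sumTo-cong n (λ x x<n → cnorm-low (<⇒≤ x<n)))
                 (sumTo-cong n (λ y y<n → cnorm-high (<⇒≤ y<n))) ⟩
  sumTo id n + sumTo (n ∸_) n                                        ≡⟨ sumTo-distrib-+ id (n ∸_) n ⟨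
  sumTo (λ x → x + (n ∸ x)) n                                        ≡⟨ sumTo-cong n (λ x x<n → m+[n∸m]≡n (<⇒≤ x<n)) ⟩
  sumTo (λ _ → n) n                                                  ≡⟨ sumTo-const n n ⟩
  n * n                                                              ∎
  where open ≡-Reasoning

sumTo-1⊔cnorm : ∀ L → sumTo (λ x → 1 ⊔ cnorm (suc L) x) (suc L) ≡ suc (sumTo (cnorm (suc L)) (suc L))
sumTo-1⊔cnorm L = cong suc (sumTo-cong L (λ b b<L → 1⊔cnorm z<s (s≤s b<L)))

module _ (n : ℕ) where

  transmission-rim : ∀ a → transmission (H n) (dist n) (inj₁ a) ≡
                     sumTo (cnorm (n + n)) (n + n) + hubSum n (λ x → 1 ⊔ cnorm (n + n) x) (toℕ a)
  transmission-rim a = trans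
    (sum-vertices-H n (dist n (inj₁ a)) (λ b → cnorm (n + n) ∣ toℕ a - b ∣)
                      (λ j → 1 ⊔ cnorm (n + n) ∣ toℕ a - suc (2 * j) ∣)
                      (λ _ → refl) (λ j → cong (λ x → 1 ⊔ cnorm (n + n) ∣ toℕ a - x ∣) (toℕ-hubPos n j)))
    (cong (_+ hubSum n (λ x → 1 ⊔ cnorm (n + n) x) (toℕ a)) (sumTo-rotate (cnorm-palindromic (n + n)) (toℕ<n a)))

  transmission-hub : ∀ j → transmission (H n) (dist n) (inj₂ j) ≡
                     sumTo (λ x → 1 ⊔ cnorm (n + n) x) (n + n) + hubSum n (cnorm (n + n)) 1
  transmission-hub j = trans
    (sum-vertices-H n (dist n (inj₂ j)) (λ b → 1 ⊔ cnorm (n + n) ∣ suc (2 * toℕ j) - b ∣)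
                      (λ i → cnorm (n + n) ∣ suc (2 * toℕ j) - suc (2 * i) ∣)
                      (λ b → cong (λ x → 1 ⊔ cnorm (n + n) ∣ x - toℕ b ∣) (toℕ-hubPos n j))
                      (λ i → cong₂ (λ x y → cnorm (n + n) ∣ x - y ∣) (toℕ-hubPos n j) (toℕ-hubPos n i)))
    (cong₂ _+_ (sumTo-rotate (palindromic-∘ (1 ⊔_) (cnorm-palindromic (n + n))) (hubPos< n j))
               (hubSum-odd n (cnorm-palindromic (n + n)) (toℕ j) (hubPos< n j)))

n²≡e+[e+1] : ∀ k → suc (k + k) * suc (k + k) ≡ (k * (2 * k) + 2 * k) + suc (k * (2 * k) + 2 * k)
n²≡e+[e+1] = solve-∀

3n²+1≡2[n²+e+1] : ∀ k → 3 * suc (k + k) * suc (k + k) + 1 ≡ (suc (k + k) * suc (k + k) + suc (k * (2 * k) + 2 * k)) * 2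
3n²+1≡2[n²+e+1] = solve-∀

2[1+k+j]≡n+2j+1 : ∀ k j → 2 * (suc k + j) ≡ suc (k + k) + suc (2 * j)
2[1+k+j]≡n+2j+1 = solve-∀

module _ (k : ℕ) where

  private
    n = suc (k + k)
    m = n + n
    e = k * (2 * k) + 2 * k

  sumTo-cnorm-even : sumTo (λ j → cnorm m (2 * j)) n ≡ e
  sumTo-cnorm-even = begin
    sumTo f (suc k + k)                                   ≡⟨ sumTo-+ f (suc k) k ⟩
    sumTo f (suc k) + sumTo (λ i → f (suc k + i)) k       ≡⟨ cong (_+ sumTo (λ i → f (suc k + i)) k) (sumTo-suc f k) ⟩
    sumTo f k + f k + sumTo (λ i → f (suc k + i)) k       ≡⟨ xy∙z≈xz∙y (sumTo f k) (f k) _ ⟩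
    sumTo f k + sumTo (λ i → f (suc k + i)) k + f k       ≡⟨ cong (_+ f k) (sumTo-distrib-+ f (λ i → f (suc k + i)) k) ⟨
    sumTo (λ i → f i + f (suc k + i)) k + f k
      ≡⟨ cong₂ _+_ (trans (sumTo-cong k pair) (sumTo-const (2 * k) k)) (cnorm-low 2k≤n) ⟩
    k * (2 * k) + 2 * k                                   ∎
    where
    open ≡-Reasoning
    f : ℕ → ℕ
    f j = cnorm m (2 * j)
    2k≡k+k : 2 * k ≡ k + k
    2k≡k+k = cong (k +_) (+-identityʳ k)
    2k≤n : 2 * k ≤ n
    2k≤n = ≤-trans (≤-reflexive 2k≡k+k) (n≤1+n (k + k))
    pair : ∀ i → i < k → f i + f (suc k + i) ≡ 2 * k
    pair i i<k = begin
      f i + f (suc k + i)                       ≡⟨ cong₂ _+_ (cnorm-low (≤-trans 2i≤k+k (n≤1+n _)))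
                                                             (cong (cnorm m) (2[1+k+j]≡n+2j+1 k i)) ⟩
      2 * i + cnorm m (n + suc (2 * i))         ≡⟨ cong (2 * i +_) (cnorm-high (s≤s 2i≤k+k)) ⟩
      2 * i + (k + k ∸ 2 * i)                   ≡⟨ m+[n∸m]≡n 2i≤k+k ⟩
      k + k                                     ≡⟨ 2k≡k+k ⟨
      2 * k                                     ∎
      where
      2i≤k+k : 2 * i ≤ k + k
      2i≤k+k = ≤-trans (*-monoʳ-≤ 2 (<⇒≤ i<k)) (≤-reflexive 2k≡k+k)

  sumTo-cnorm-odd : sumTo (λ j → cnorm m (suc (2 * j))) n ≡ suc e
  sumTo-cnorm-odd = +-cancelˡ-≡ e _ _ (begin
    e + sumTo (λ j → cnorm m (suc (2 * j))) n
      ≡⟨ cong (_+ sumTo (λ j → cnorm m (suc (2 * j))) n) sumTo-cnorm-even ⟨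
    sumTo (λ j → cnorm m (2 * j)) n + sumTo (λ j → cnorm m (suc (2 * j))) n
      ≡⟨ sumTo-even+odd (cnorm m) n ⟨
    sumTo (cnorm m) m                           ≡⟨ sumTo-cnorm n ⟩
    n * n                                       ≡⟨ n²≡e+[e+1] k ⟩
    e + suc e                                   ∎)
    where open ≡-Reasoning

  hubSum-1⊔cnorm-0 : hubSum n (λ x → 1 ⊔ cnorm m x) 0 ≡ suc e
  hubSum-1⊔cnorm-0 = trans (sumTo-cong n (λ j j<n → 1⊔cnorm z<s (2j+1<2n j<n))) sumTo-cnorm-odd

  hubSum-1⊔cnorm-1 : hubSum n (λ x → 1 ⊔ cnorm m x) 1 ≡ suc e
  hubSum-1⊔cnorm-1 = cong suc (trans (sumTo-cong (k + k) (λ j j<2k → 1⊔cnorm z<s (2j<2n (s≤s j<2k))))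
                                     sumTo-cnorm-even)
    where
    2j<2n : ∀ {j} → j < n → 2 * j < m
    2j<2n j<n = <-trans (n<1+n _) (2j+1<2n j<n)

  transmission-odd : ∀ v → transmission (H n) (dist n) v ≡ n * n + suc e
  transmission-odd (inj₁ a) with hubSum-parity n (palindromic-∘ (1 ⊔_) (cnorm-palindromic m)) (toℕ a) (toℕ<n a)
  ... | inj₁ even = trans (transmission-rim n a) (cong₂ _+_ (sumTo-cnorm n) (trans even hubSum-1⊔cnorm-0))
  ... | inj₂ odd  = trans (transmission-rim n a) (cong₂ _+_ (sumTo-cnorm n) (trans odd hubSum-1⊔cnorm-1))
  transmission-odd (inj₂ j) = begin
    transmission (H n) (dist n) (inj₂ j)                               ≡⟨ transmission-hub n j ⟩
    sumTo (λ x → 1 ⊔ cnorm m x) m + hubSum n (cnorm m) 1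
      ≡⟨ cong₂ _+_ (sumTo-1⊔cnorm (k + k + n)) sumTo-cnorm-even ⟩
    suc (sumTo (cnorm m) m) + e                                        ≡⟨ cong (λ x → suc x + e) (sumTo-cnorm n) ⟩
    suc (n * n) + e                                                    ≡⟨ +-suc (n * n) e ⟨
    n * n + suc e                                                      ∎
    where open ≡-Reasoning

  H-transmissionRegular-odd : TransmissionRegularWith (H n) ((3 * n * n + 1) / 2)
  H-transmissionRegular-odd = dist n , H-isDistance n , λ v → trans (transmission-odd v) (sym half)
    where
    half : (3 * n * n + 1) / 2 ≡ n * n + suc e
    half = trans (cong (_/ 2) (3n²+1≡2[n²+e+1] k)) (m*n/n≡m (n * n + suc e) 2)

n%2≡1⇒n≡1+2[n/2] : ∀ n → n % 2 ≡ 1 → n ≡ suc (n / 2 + n / 2)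
n%2≡1⇒n≡1+2[n/2] n n%2≡1 = trans (m≡m%n+[m/n]*n n 2)
  (cong₂ _+_ n%2≡1 (trans (*-comm (n / 2) 2) (cong (n / 2 +_) (+-identityʳ (n / 2)))))

proposition4p2 : (∀ (n : ℕ) → 2 ≤ n → ¬ Regular (H n))
    × (∀ (n : ℕ) → 3 ≤ n → n % 2 ≡ 1 → TransmissionRegularWith (H n) ((3 * n * n + 1) / 2))
proposition4p2 = H-not-regular , λ n _ n%2≡1 →
  subst (λ n → TransmissionRegularWith (H n) ((3 * n * n + 1) / 2))
        (sym (n%2≡1⇒n≡1+2[n/2] n n%2≡1)) (H-transmissionRegular-odd (n / 2))
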